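{- Let $p_1,\dots,p_k,b\in\mathbb{Z}$, let $\mathcal{L}_1$ denote the equation $p_1x_1+\dots+p_kx_k=b$ and let $\mathcal{L}_2$ denote the equation $(p_1+p_2)x_1+p_3x_2+\dots+p_kx_{k-1}=b$. Then $\mu_{\mathcal{L}_1}(n)\leq\mu_{\mathcal{L}_2}(n)$.
   Context: For a linear equation $a_1x_1+\dots+a_kx_k=b$, it is translation-invariant if $\sum_i a_i=b=0$. A solution $(x_1,\dots,x_k)$ is trivial if the equation is translation-invariant and there is a partition $P_1,\dots,P_\ell$ of $[k]$ such that $x_i=x_j$ whenever $i,j$ lie in the same class and $\sum_{i\in P_s}a_i=0$ for every class $P_s$. A set $A\subseteq[n]$ is $\mathcal{L}$-free if it contains no non-trivial solution to $\mathcal{L}$ (i.e. no non-trivial solution with all $x_i\in A$). $\mu_{\mathcal{L}}(n)$ is the maximum size of an $\mathcal{L}$-free subset of $[n]=\{1,\dots,n\}$. -}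

module Defs where

open import Data.Nat using (ℕ; zero; suc; _≤_)
open import Data.Integer using (ℤ; +_; _+_; _*_; 0ℤ)
open import Data.Fin using (Fin; zero; suc; toℕ)
open import Data.Fin.Subset using (Subset; _∈_; ∣_∣)
open import Data.Product using (Σ; _×_; _,_)
open import Relation.Binary.PropositionalEquality using (_≡_)
open import Relation.Nullary using (¬_)
open import Relation.Nullary.Decidable using (does)
open import Data.Fin using (_≟_)
open import Data.Bool using (if_then_else_)

sumℤ : {k : ℕ} → (Fin k → ℤ) → ℤ
sumℤ {zero}  f = 0ℤ
sumℤ {suc k} f = f zero + sumℤ (λ i → f (suc i))

record LinEq (k : ℕ) : Set where
  constructor linEq
  field
    coeff : Fin k → ℤ
    rhs   : ℤ
open LinEq public

-- The element of [n] = {1,…,n} represented by i : Fin n is toℕ i + 1.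
val : {n : ℕ} → Fin n → ℤ
val i = + suc (toℕ i)

IsSolution : {k n : ℕ} → LinEq k → (Fin k → Fin n) → Set
IsSolution L x = sumℤ (λ i → coeff L i * val (x i)) ≡ rhs L

TranslationInvariant : {k : ℕ} → LinEq k → Set
TranslationInvariant L = (sumℤ (coeff L) ≡ 0ℤ) × (rhs L ≡ 0ℤ)

classSum : {k : ℕ} → LinEq k → (Fin k → Fin k) → Fin k → ℤ
classSum L c s = sumℤ (λ i → if does (c i ≟ s) then coeff L i else 0ℤ)

-- A partition of [k] is encoded by a labelling c : Fin k → Fin k; the classes
-- are the nonempty fibres of c (empty fibres contribute a zero sum).
IsTrivial : {k n : ℕ} → LinEq k → (Fin k → Fin n) → Set
IsTrivial {k} L x =
  TranslationInvariant L ×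
  Σ (Fin k → Fin k) (λ c →
     ((i j : Fin k) → c i ≡ c j → x i ≡ x j) ×
     ((s : Fin k) → classSum L c s ≡ 0ℤ))

IsFree : {k n : ℕ} → LinEq k → Subset n → Set
IsFree L A = ∀ x → (∀ i → x i ∈ A) → IsSolution L x → IsTrivial L x

IsMu : {k : ℕ} → LinEq k → ℕ → ℕ → Set
IsMu L n m =
  Σ (Subset n) (λ A → IsFree L A × ∣ A ∣ ≡ m) ×
  ((A : Subset n) → IsFree L A → ∣ A ∣ ≤ m)

mergeCoeff : {m : ℕ} → (Fin (suc (suc m)) → ℤ) → Fin (suc m) → ℤ
mergeCoeff p zero    = p zero + p (suc zero)
mergeCoeff p (suc i) = p (suc (suc i))

-- An L₂-solution x becomes an L₁-solution by repeating its first entry, so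
-- an L₁-free set is L₂-free. The delicate point is triviality: a solution is
-- trivial iff the equation is translation-invariant and, for every value v,
-- the coefficients of the variables equal to v sum to zero. Both conditions
-- are unchanged by merging the first two coefficients, since the merged
-- variables carry the same value.
module Submission where

open import Defs
open import Data.Nat using (ℕ; zero; suc; _≤_)
open import Data.Integer using (ℤ; 0ℤ; _+_; _*_)
open import Data.Integer.Properties
  using (+-0-commutativeMonoid; +-identityˡ; +-identityʳ; +-assoc; *-distribʳ-+)
open import Data.Fin using (Fin; zero; suc; _≟_)
open import Data.Fin.Properties using (any?)
open import Data.Fin.Subset using (Subset)
open import Data.Bool using (true; false; if_then_else_)
open import Data.Empty using (⊥-elim-irr)
open import Data.Product using (∃; _,_; proj₁; proj₂)
open import Function using (_∘_)
open import Function.Bundles using (mk⇔)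
open import Relation.Binary.PropositionalEquality
open import Relation.Nullary using (does; yes; no)
open import Relation.Nullary.Decidable using (dec-true; dec-false; does-⇔)
open import Algebra.Properties.CommutativeMonoid.Sum +-0-commutativeMonoid
  using (sum; sum-cong-≗; ∑-comm; sum-replicate-zero)

sumℤ≡sum : ∀ {k} (f : Fin k → ℤ) → sumℤ f ≡ sum f
sumℤ≡sum {zero}  f = refl
sumℤ≡sum {suc k} f = cong (f zero +_) (sumℤ≡sum (f ∘ suc))

sumℤ-cong : ∀ {k} {f g : Fin k → ℤ} → (∀ i → f i ≡ g i) → sumℤ f ≡ sumℤ g
sumℤ-cong {f = f} {g} f≗g = trans (sumℤ≡sum f) (trans (sum-cong-≗ f≗g) (sym (sumℤ≡sum g)))

sumℤ-zero : ∀ {k} {f : Fin k → ℤ} → (∀ i → f i ≡ 0ℤ) → sumℤ f ≡ 0ℤ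
sumℤ-zero {k} f≗0 = trans (sumℤ-cong f≗0) (trans (sumℤ≡sum {k} (λ _ → 0ℤ)) (sum-replicate-zero k))

sumℤ-comm : ∀ {k l} (f : Fin k → Fin l → ℤ) →
  sumℤ (λ i → sumℤ (f i)) ≡ sumℤ (λ s → sumℤ (λ i → f i s))
sumℤ-comm f = begin
  sumℤ (λ i → sumℤ (f i))          ≡⟨ sumℤ-cong (λ i → sumℤ≡sum (f i)) ⟩
  sumℤ (λ i → sum (f i))           ≡⟨ sumℤ≡sum (λ i → sum (f i)) ⟩
  sum (λ i → sum (f i))            ≡⟨ ∑-comm f ⟩
  sum (λ s → sum (λ i → f i s))    ≡⟨ sumℤ≡sum (λ s → sum (λ i → f i s)) ⟨
  sumℤ (λ s → sum (λ i → f i s))   ≡⟨ sumℤ-cong (λ s → sumℤ≡sum (λ i → f i s)) ⟨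
  sumℤ (λ s → sumℤ (λ i → f i s))  ∎
  where open ≡-Reasoning

sumℤ-indicator : ∀ {l} (j : Fin l) (t : ℤ) → sumℤ (λ s → if does (j ≟ s) then t else 0ℤ) ≡ t
sumℤ-indicator {suc l} zero t = trans (cong (t +_) (sumℤ-zero {l} λ _ → refl)) (+-identityʳ t)
sumℤ-indicator (suc j) t = trans (+-identityˡ _) (sumℤ-indicator j t)

if-additive : ∀ b (t u : ℤ) → (if b then t + u else 0ℤ) ≡ (if b then t else 0ℤ) + (if b then u else 0ℤ)
if-additive true  t u = refl
if-additive false t u = refl

-- classSum L c s is definitionally fibreSum (coeff L) c s.
fibreSum : ∀ {k n} → (Fin k → ℤ) → (Fin k → Fin n) → Fin n → ℤ
fibreSum a y v = sumℤ (λ i → if does (y i ≟ v) then a i else 0ℤ)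

ZeroFibreSums : ∀ {k n} → (Fin k → ℤ) → (Fin k → Fin n) → Set
ZeroFibreSums a y = ∀ v → fibreSum a y v ≡ 0ℤ

-- Each fibre of y is a union of classes of c, and each class sums to zero.
zeroFibreSums-coarsen : ∀ {k l n} (a : Fin k → ℤ) (c : Fin k → Fin l) (y : Fin k → Fin n) →
  (∀ i j → c i ≡ c j → y i ≡ y j) → ZeroFibreSums a c → ZeroFibreSums a y
zeroFibreSums-coarsen {k} {l} a c y c-refines-y c-zero v = begin
  fibreSum a y v                           ≡⟨ sumℤ-cong (λ i → sumℤ-indicator (c i) (fibreTerm i)) ⟨
  sumℤ (λ i → sumℤ (λ s → classTerm s i))  ≡⟨ sumℤ-comm (λ i s → classTerm s i) ⟩
  sumℤ (λ s → sumℤ (classTerm s))          ≡⟨ sumℤ-zero classPart ⟩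
  0ℤ                                       ∎
  where
  open ≡-Reasoning
  fibreTerm : Fin k → ℤ
  fibreTerm i = if does (y i ≟ v) then a i else 0ℤ
  classTerm : Fin l → Fin k → ℤ
  classTerm s i = if does (c i ≟ s) then fibreTerm i else 0ℤ
  classPart : ∀ s → sumℤ (classTerm s) ≡ 0ℤ
  classPart s with any? (λ i → c i ≟ s)
  ... | no s∉c = sumℤ-zero outside
    where
    outside : ∀ i → classTerm s i ≡ 0ℤ
    outside i rewrite dec-false (c i ≟ s) (λ ci≡s → s∉c (i , ci≡s)) = refl
  ... | yes (i₀ , ci₀≡s) with y i₀ ≟ v
  ... | yes yi₀≡v = trans (sumℤ-cong inside) (c-zero s)
    where
    inside : ∀ i → classTerm s i ≡ (if does (c i ≟ s) then a i else 0ℤ)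
    inside i with c i ≟ s
    ... | no  _    = refl
    ... | yes ci≡s
      rewrite dec-true (y i ≟ v) (trans (c-refines-y i i₀ (trans ci≡s (sym ci₀≡s))) yi₀≡v) = refl
  ... | no yi₀≢v = sumℤ-zero outside
    where
    outside : ∀ i → classTerm s i ≡ 0ℤ
    outside i with c i ≟ s
    ... | no  _    = refl
    ... | yes ci≡s
      rewrite dec-false (y i ≟ v) (yi₀≢v ∘ trans (c-refines-y i₀ i (trans ci₀≡s (sym ci≡s)))) = refl

module Representative {k n} (x : Fin k → Fin n) where

  -- The irrelevant argument makes the chosen preimage depend on v alone.
  preimage : (v : Fin n) → .(∃ λ j → x j ≡ v) → ∃ λ j → x j ≡ v
  preimage v v∈image with any? (λ j → x j ≟ v)
  ... | yes j       = j
  ... | no v∉image = ⊥-elim-irr (v∉image v∈image)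

  preimage-cong : ∀ {v w} .(v∈image : ∃ λ j → x j ≡ v) .(w∈image : ∃ λ j → x j ≡ w) →
    v ≡ w → proj₁ (preimage v v∈image) ≡ proj₁ (preimage w w∈image)
  preimage-cong _ _ refl = refl

  representative : Fin k → Fin k
  representative i = proj₁ (preimage (x i) (i , refl))

  x∘representative : ∀ i → x (representative i) ≡ x i
  x∘representative i = proj₂ (preimage (x i) (i , refl))

  representative-cong : ∀ i j → x i ≡ x j → representative i ≡ representative j
  representative-cong i j = preimage-cong (i , refl) (j , refl)

  representative-refines : ∀ i j → representative i ≡ representative j → x i ≡ x j
  representative-refines i j ri≡rj =
    trans (sym (x∘representative i)) (trans (cong x ri≡rj) (x∘representative j))

  -- A nonempty class of representative is a whole fibre of x.
  zeroFibreSums-representative : (a : Fin k → ℤ) → ZeroFibreSums a x → ZeroFibreSums a representative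
  zeroFibreSums-representative a x-zero s with any? (λ i → representative i ≟ s)
  ... | no s∉image = sumℤ-zero outside
    where
    outside : ∀ i → (if does (representative i ≟ s) then a i else 0ℤ) ≡ 0ℤ
    outside i rewrite dec-false (representative i ≟ s) (λ ri≡s → s∉image (i , ri≡s)) = refl
  ... | yes (i₀ , ri₀≡s) = trans (sumℤ-cong sameClass) (x-zero (x i₀))
    where
    sameClass : ∀ i → (if does (representative i ≟ s) then a i else 0ℤ)
                    ≡ (if does (x i ≟ x i₀) then a i else 0ℤ)
    sameClass i
      rewrite does-⇔ (mk⇔ (λ ri≡s → representative-refines i i₀ (trans ri≡s (sym ri₀≡s)))
                          (λ xi≡xi₀ → trans (representative-cong i i₀ xi≡xi₀) ri₀≡s))
                     (representative i ≟ s) (x i ≟ x i₀) = refl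

trivial⇒zeroFibreSums : ∀ {k n} (L : LinEq k) (x : Fin k → Fin n) →
  IsTrivial L x → ZeroFibreSums (coeff L) x
trivial⇒zeroFibreSums L x (_ , c , c-refines-x , c-zero) = zeroFibreSums-coarsen (coeff L) c x c-refines-x c-zero

zeroFibreSums⇒trivial : ∀ {k n} (L : LinEq k) (x : Fin k → Fin n) →
  TranslationInvariant L → ZeroFibreSums (coeff L) x → IsTrivial L x
zeroFibreSums⇒trivial L x invariant x-zero =
  invariant , representative , representative-refines , zeroFibreSums-representative (coeff L) x-zero
  where open Representative x

duplicateHead : ∀ {m} {A : Set} → (Fin (suc m) → A) → Fin (suc (suc m)) → A
duplicateHead x zero    = x zero
duplicateHead x (suc i) = x i

-- g abstracts the three sums that must survive merging: the weighted sum of a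
-- solution, the coefficient sum and each fibre sum.
sumℤ-mergeCoeff : ∀ {m} (p : Fin (suc (suc m)) → ℤ) (g : Fin (suc m) → ℤ → ℤ) →
  (∀ t u → g zero (t + u) ≡ g zero t + g zero u) →
  sumℤ (λ i → g i (mergeCoeff p i)) ≡ sumℤ (λ i → duplicateHead g i (p i))
sumℤ-mergeCoeff p g g₀-additive =
  trans (cong (_+ rest) (g₀-additive p₀ p₁)) (+-assoc (g zero p₀) (g zero p₁) rest)
  where
  p₀ p₁ rest : ℤ
  p₀ = p zero
  p₁ = p (suc zero)
  rest = sumℤ (λ i → g (suc i) (p (suc (suc i))))

free-mergeCoeff : ∀ {m n} (p : Fin (suc (suc m)) → ℤ) (b : ℤ) (A : Subset n) →
  IsFree (linEq p b) A → IsFree (linEq (mergeCoeff p) b) A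
free-mergeCoeff {m} {n} p b A A-free x x∈A x-solution =
  zeroFibreSums⇒trivial (linEq (mergeCoeff p) b) x merged-invariant merged-zeroFibreSums
  where
  x′ : Fin (suc (suc m)) → Fin n
  x′ = duplicateHead x
  x′-trivial : IsTrivial (linEq p b) x′
  x′-trivial = A-free x′ (λ { zero → x∈A zero ; (suc i) → x∈A i })
    (trans (sym (sumℤ-mergeCoeff p (λ i t → t * val (x i)) (λ t u → *-distribʳ-+ _ t u))) x-solution)
  merged-invariant : TranslationInvariant (linEq (mergeCoeff p) b)
  merged-invariant with x′-trivial
  ... | (coeffSum≡0 , rhs≡0) , _ = trans (sumℤ-mergeCoeff p (λ _ t → t) (λ _ _ → refl)) coeffSum≡0 , rhs≡0
  merged-zeroFibreSums : ZeroFibreSums (mergeCoeff p) x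
  merged-zeroFibreSums v =
    trans (sumℤ-mergeCoeff p (λ i t → if does (x i ≟ v) then t else 0ℤ) (if-additive _))
          (trivial⇒zeroFibreSums (linEq p b) x′ x′-trivial v)

isMu-mono : ∀ {k l n μ μ′} (L : LinEq k) (L′ : LinEq l) →
  (∀ A → IsFree L A → IsFree L′ A) → IsMu L n μ → IsMu L′ n μ′ → μ ≤ μ′
isMu-mono L L′ free⇒free ((A , A-free , ∣A∣≡μ) , _) (_ , maximal′) =
  subst (_≤ _) ∣A∣≡μ (maximal′ A (free⇒free A A-free))

proposition2p7 : (m : ℕ) (p : Fin (suc (suc m)) → ℤ) (b : ℤ) (n μ₁ μ₂ : ℕ) →
    IsMu (linEq p b) n μ₁ → IsMu (linEq (mergeCoeff p) b) n μ₂ → μ₁ ≤ μ₂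
proposition2p7 m p b n μ₁ μ₂ =
  isMu-mono (linEq p b) (linEq (mergeCoeff p) b) (free-mergeCoeff p b)
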